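{- For every integer $n\ge0$, \[ J_{n+1}=\sum_{k=0}^n\ \sum_{b=\max(0,\lceil k-n/2\rceil)}^{\lfloor k/2\rfloor}\binom{n-k+b}{k-b}\binom{k-b}{b}, \] where an inner sum whose lower limit exceeds its upper limit is $0$.
   Context: Jacobsthal numbers: $J_0=0$, $J_1=1$, $J_m=J_{m-1}+2J_{m-2}$ for $m\ge2$. -}

module Defs where

open import Data.Nat using (ℕ; zero; suc; _+_; _*_; _∸_; _≤?_; _⊔_)
open import Data.Nat.DivMod using (_/_)
open import Relation.Nullary using (yes; no)

J : ℕ → ℕ
J zero = 0
J (suc zero) = 1
J (suc (suc m)) = J (suc m) + 2 * J m

sumTo : ℕ → (ℕ → ℕ) → ℕ
sumTo zero f = f 0
sumTo (suc n) f = sumTo n f + f (suc n)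

sumFromTo : ℕ → ℕ → (ℕ → ℕ) → ℕ
sumFromTo lo hi f with lo Data.Nat.≤? hi
... | yes _ = sumTo (hi ∸ lo) (λ i → f (lo + i))
... | no _  = 0

-- max(0, ⌈k - n/2⌉) = ⌈max(0, 2k - n) / 2⌉ computed in ℕ
lowerLim : ℕ → ℕ → ℕ
lowerLim n k = (suc ((2 * k) ∸ n)) / 2

-- Outside b ∈ [max(0, ⌈k - n/2⌉), ⌊k/2⌋] one of the two binomial factors vanishes, so
-- the inner sums may run over all b ≤ k. Putting a = k - b, the summand becomes
-- C(n-a, a) C(a, b), and summing over b first turns the double sum into
-- Σ_a C(n-a, a) 2^a, which satisfies the Jacobsthal recurrence by Pascal's rule.
module Submission where

open import Defs
open import Data.Nat using (ℕ; zero; suc; _+_; _*_; _∸_; _^_; _≤_; _<_; _≤?_; z≤n; s≤s; s≤s⁻¹)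
open import Data.Nat.Properties
open import Data.Nat.DivMod using (_/_; m/n*n≤m; m/n≤m; m*n/n≡m; /-monoˡ-≤)
open import Data.Nat.Combinatorics using (_C_; nCk+nC[k+1]≡[n+1]C[k+1]; k>n⇒nCk≡0)
open import Data.Nat.Tactic.RingSolver using (solve-∀)
open import Relation.Binary.PropositionalEquality
  using (_≡_; refl; sym; trans; cong; cong₂; subst; module ≡-Reasoning)
open import Relation.Nullary using (yes; no)

sumTo-cong : ∀ n {f g : ℕ → ℕ} → (∀ i → i ≤ n → f i ≡ g i) → sumTo n f ≡ sumTo n g
sumTo-cong zero    f≗g = f≗g 0 z≤n
sumTo-cong (suc n) f≗g =
  cong₂ _+_ (sumTo-cong n (λ i i≤n → f≗g i (m≤n⇒m≤1+n i≤n))) (f≗g (suc n) ≤-refl)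

sumTo-suc : ∀ n (f : ℕ → ℕ) → sumTo (suc n) f ≡ f 0 + sumTo n (λ i → f (suc i))
sumTo-suc zero    f = refl
sumTo-suc (suc n) f = trans (cong (_+ f (suc (suc n))) (sumTo-suc n f)) (+-assoc (f 0) _ _)

sumTo-distrib-+ : ∀ n (f g : ℕ → ℕ) → sumTo n (λ i → f i + g i) ≡ sumTo n f + sumTo n g
sumTo-distrib-+ zero    f g = refl
sumTo-distrib-+ (suc n) f g =
  trans (cong (_+ (f (suc n) + g (suc n))) (sumTo-distrib-+ n f g))
        (+-interchange (sumTo n f) (sumTo n g) (f (suc n)) (g (suc n)))
  where
  +-interchange : ∀ a b c d → a + b + (c + d) ≡ a + c + (b + d)
  +-interchange = solve-∀

sumTo-distribˡ-* : ∀ n c (f : ℕ → ℕ) → sumTo n (λ i → c * f i) ≡ c * sumTo n f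
sumTo-distribˡ-* zero    c f = refl
sumTo-distribˡ-* (suc n) c f =
  trans (cong (_+ c * f (suc n)) (sumTo-distribˡ-* n c f)) (sym (*-distribˡ-+ c (sumTo n f) _))

sumTo-zeros : ∀ n (f : ℕ → ℕ) → (∀ i → i ≤ n → f i ≡ 0) → sumTo n f ≡ 0
sumTo-zeros zero    f f≡0 = f≡0 0 z≤n
sumTo-zeros (suc n) f f≡0 =
  cong₂ _+_ (sumTo-zeros n f (λ i i≤n → f≡0 i (m≤n⇒m≤1+n i≤n))) (f≡0 (suc n) ≤-refl)

sumTo-zerosAbove : ∀ m n (f : ℕ → ℕ) → m ≤ n → (∀ i → m < i → f i ≡ 0) →
                   sumTo n f ≡ sumTo m f
sumTo-zerosAbove m n f m≤n f≡0 = begin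
  sumTo n f             ≡⟨ cong (λ x → sumTo x f) (sym (m+[n∸m]≡n m≤n)) ⟩
  sumTo (m + (n ∸ m)) f ≡⟨ pad (n ∸ m) ⟩
  sumTo m f             ∎
  where
  open ≡-Reasoning
  pad : ∀ d → sumTo (m + d) f ≡ sumTo m f
  pad zero    = cong (λ x → sumTo x f) (+-identityʳ m)
  pad (suc d) rewrite +-suc m d =
    trans (cong₂ _+_ (pad d) (f≡0 (suc (m + d)) (s≤s (m≤m+n m d)))) (+-identityʳ _)

sumTo-zerosBelow : ∀ lo d (f : ℕ → ℕ) → (∀ i → i < lo → f i ≡ 0) →
                   sumTo (lo + d) f ≡ sumTo d (λ i → f (lo + i))
sumTo-zerosBelow zero     d f f≡0 = refl
sumTo-zerosBelow (suc lo) d f f≡0 = begin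
  sumTo (suc (lo + d)) f                  ≡⟨ sumTo-suc (lo + d) f ⟩
  f 0 + sumTo (lo + d) (λ i → f (suc i))  ≡⟨ cong (_+ sumTo (lo + d) (λ i → f (suc i))) (f≡0 0 (s≤s z≤n)) ⟩
  sumTo (lo + d) (λ i → f (suc i))        ≡⟨ sumTo-zerosBelow lo d _ (λ i i<lo → f≡0 (suc i) (s≤s i<lo)) ⟩
  sumTo d (λ i → f (suc lo + i))          ∎
  where open ≡-Reasoning

sumTo-reverse : ∀ n (f : ℕ → ℕ) → sumTo n f ≡ sumTo n (λ i → f (n ∸ i))
sumTo-reverse zero    f = refl
sumTo-reverse (suc n) f = begin
  sumTo (suc n) f                                    ≡⟨ sumTo-suc n f ⟩
  f 0 + sumTo n (λ i → f (suc i))                    ≡⟨ cong (f 0 +_) (sumTo-reverse n _) ⟩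
  f 0 + sumTo n (λ i → f (suc (n ∸ i)))              ≡⟨ cong (f 0 +_) (sumTo-cong n (λ i i≤n →
                                                          cong f (sym (+-∸-assoc 1 i≤n)))) ⟩
  f 0 + sumTo n (λ i → f (suc n ∸ i))                ≡⟨ +-comm (f 0) _ ⟩
  sumTo n (λ i → f (suc n ∸ i)) + f 0                ≡⟨ cong (λ x → sumTo n (λ i → f (suc n ∸ i)) + f x) (sym (n∸n≡0 n)) ⟩
  sumTo n (λ i → f (suc n ∸ i)) + f (suc n ∸ suc n)  ∎
  where open ≡-Reasoning

sumTo-triangle : ∀ (g : ℕ → ℕ → ℕ) n →
  sumTo n (λ k → sumTo k (λ b → g (k ∸ b) b)) ≡ sumTo n (λ a → sumTo (n ∸ a) (g a))
sumTo-triangle g zero    = refl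
sumTo-triangle g (suc n) = begin
  sumTo n (λ k → sumTo k (λ b → g (k ∸ b) b)) + sumTo (suc n) (λ b → g (suc n ∸ b) b)
    ≡⟨ cong₂ _+_ (sumTo-triangle g n) newDiagonal ⟩
  rows + (diagonal + g (suc n) 0)
    ≡⟨ sym (+-assoc rows diagonal _) ⟩
  (rows + diagonal) + g (suc n) 0
    ≡⟨ cong₂ _+_ (sym longerRows) (cong (λ x → sumTo x (g (suc n))) (sym (n∸n≡0 n))) ⟩
  sumTo n (λ a → sumTo (suc n ∸ a) (g a)) + sumTo (suc n ∸ suc n) (g (suc n))
    ∎
  where
  open ≡-Reasoning
  rows     = sumTo n (λ a → sumTo (n ∸ a) (g a))
  diagonal = sumTo n (λ a → g a (suc n ∸ a))
  newDiagonal : sumTo (suc n) (λ b → g (suc n ∸ b) b) ≡ diagonal + g (suc n) 0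
  newDiagonal = trans (sumTo-reverse (suc n) _)
    (trans (sumTo-cong (suc n) (λ a a≤1+n → cong (λ x → g x (suc n ∸ a)) (m∸[m∸n]≡n a≤1+n)))
           (cong (λ x → diagonal + g (suc n) x) (n∸n≡0 n)))
  longerRows : sumTo n (λ a → sumTo (suc n ∸ a) (g a)) ≡ rows + diagonal
  longerRows = trans
    (sumTo-cong n (λ a a≤n → trans (cong (λ x → sumTo x (g a)) (+-∸-assoc 1 a≤n))
                                   (cong (λ x → sumTo (n ∸ a) (g a) + g a x) (sym (+-∸-assoc 1 a≤n)))))
    (sumTo-distrib-+ n _ _)

sumFromTo≡sumTo : ∀ lo hi k (f : ℕ → ℕ) → hi ≤ k →
  (∀ i → i < lo → f i ≡ 0) → (∀ i → hi < i → f i ≡ 0) → sumFromTo lo hi f ≡ sumTo k f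
sumFromTo≡sumTo lo hi k f hi≤k below above with lo ≤? hi
... | yes lo≤hi = sym (begin
  sumTo k f                                ≡⟨ sumTo-zerosAbove hi k f hi≤k above ⟩
  sumTo hi f                               ≡⟨ cong (λ x → sumTo x f) (sym (m+[n∸m]≡n lo≤hi)) ⟩
  sumTo (lo + (hi ∸ lo)) f                 ≡⟨ sumTo-zerosBelow lo (hi ∸ lo) f below ⟩
  sumTo (hi ∸ lo) (λ i → f (lo + i))       ∎)
  where open ≡-Reasoning
... | no lo≰hi = sym (sumTo-zeros k f (λ i _ → vanish i))
  where
  vanish : ∀ i → f i ≡ 0
  vanish i with i ≤? hi
  ... | yes i≤hi = below i (≤-<-trans i≤hi (≰⇒> lo≰hi))
  ... | no  i≰hi = above i (≰⇒> i≰hi)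

sumTo-C : ∀ a m → a ≤ m → sumTo m (a C_) ≡ 2 ^ a
sumTo-C zero    m       _         = sumTo-zerosAbove 0 m (0 C_) z≤n (λ { (suc i) _ → refl })
sumTo-C (suc a) (suc m) (s≤s a≤m) = begin
  sumTo (suc m) (suc a C_)                        ≡⟨ sumTo-suc m _ ⟩
  1 + sumTo m (λ b → suc a C suc b)               ≡⟨ cong (1 +_) (sumTo-cong m (λ b _ →
                                                       sym (nCk+nC[k+1]≡[n+1]C[k+1] a b))) ⟩
  1 + sumTo m (λ b → a C b + a C suc b)           ≡⟨ cong (1 +_) (sumTo-distrib-+ m _ _) ⟩
  1 + (sumTo m (a C_) + sumTo m (λ b → a C suc b)) ≡⟨ +-comm-middle 1 (sumTo m (a C_)) _ ⟩
  sumTo m (a C_) + (1 + sumTo m (λ b → a C suc b)) ≡⟨ cong (sumTo m (a C_) +_) (sumTo-suc m (a C_)) ⟨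
  sumTo m (a C_) + sumTo (suc m) (a C_)           ≡⟨ cong₂ _+_ (sumTo-C a m a≤m)
                                                       (sumTo-C a (suc m) (m≤n⇒m≤1+n a≤m)) ⟩
  2 ^ a + 2 ^ a                                   ≡⟨ cong (2 ^ a +_) (sym (+-identityʳ (2 ^ a))) ⟩
  2 ^ suc a                                       ∎
  where
  open ≡-Reasoning
  +-comm-middle : ∀ x y z → x + (y + z) ≡ y + (x + z)
  +-comm-middle = solve-∀

[1+n∸a]C[1+a] : ∀ n a → (suc n ∸ a) C suc a ≡ (n ∸ a) C a + (n ∸ a) C suc a
[1+n∸a]C[1+a] n zero = sym (nCk+nC[k+1]≡[n+1]C[k+1] n 0)
[1+n∸a]C[1+a] n (suc a) with suc a ≤? n
... | yes a<n rewrite +-∸-assoc 1 a<n = sym (nCk+nC[k+1]≡[n+1]C[k+1] (n ∸ suc a) (suc a))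
... | no  a≮n rewrite m≤n⇒m∸n≡0 (≰⇒> a≮n) | m≤n⇒m∸n≡0 (<⇒≤ (≰⇒> a≮n)) = refl

[n∸a]Ca≡0 : ∀ n a → n < a → (n ∸ a) C a ≡ 0
[n∸a]Ca≡0 n (suc a) n<a rewrite m≤n⇒m∸n≡0 (<⇒≤ n<a) = refl

diagonalSum : ℕ → ℕ
diagonalSum n = sumTo n (λ a → ((n ∸ a) C a) * 2 ^ a)

diagonalSum-rec : ∀ n → diagonalSum (suc (suc n)) ≡ diagonalSum (suc n) + 2 * diagonalSum n
diagonalSum-rec n = begin
  diagonalSum (suc (suc n))
    ≡⟨ sumTo-suc (suc n) _ ⟩
  1 + sumTo (suc n) (λ a → ((suc n ∸ a) C suc a) * 2 ^ suc a)
    ≡⟨ cong (1 +_) (sumTo-cong (suc n) (λ a _ →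
         trans (cong (_* 2 ^ suc a) ([1+n∸a]C[1+a] n a)) (*-distribʳ-+ (2 ^ suc a) ((n ∸ a) C a) ((n ∸ a) C suc a)))) ⟩
  1 + sumTo (suc n) (λ a → ((n ∸ a) C a) * 2 ^ suc a + ((n ∸ a) C suc a) * 2 ^ suc a)
    ≡⟨ cong (1 +_) (sumTo-distrib-+ (suc n) _ _) ⟩
  1 + (doubled + shifted)
    ≡⟨ rearrange 1 doubled shifted ⟩
  (1 + shifted) + doubled
    ≡⟨ cong₂ _+_ (sym unshift) double ⟩
  diagonalSum (suc n) + 2 * diagonalSum n
    ∎
  where
  open ≡-Reasoning
  doubled = sumTo (suc n) (λ a → ((n ∸ a) C a) * 2 ^ suc a)
  shifted = sumTo (suc n) (λ a → ((n ∸ a) C suc a) * 2 ^ suc a)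
  rearrange : ∀ x y z → x + (y + z) ≡ (x + z) + y
  rearrange = solve-∀
  *-double : ∀ x y → x * (2 * y) ≡ 2 * (x * y)
  *-double = solve-∀
  vanishAbove : ∀ m (f : ℕ → ℕ) → ∀ a → m < a → ((m ∸ a) C a) * f a ≡ 0
  vanishAbove m f a m<a = cong (_* f a) ([n∸a]Ca≡0 m a m<a)
  double : doubled ≡ 2 * diagonalSum n
  double = begin
    doubled                                          ≡⟨ sumTo-cong (suc n) (λ a _ → *-double ((n ∸ a) C a) (2 ^ a)) ⟩
    sumTo (suc n) (λ a → 2 * (((n ∸ a) C a) * 2 ^ a)) ≡⟨ sumTo-distribˡ-* (suc n) 2 _ ⟩
    2 * sumTo (suc n) (λ a → ((n ∸ a) C a) * 2 ^ a)   ≡⟨ cong (2 *_) (sumTo-zerosAbove n (suc n) _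
                                                          (n≤1+n n) (vanishAbove n (2 ^_))) ⟩
    2 * diagonalSum n                                ∎
  unshift : diagonalSum (suc n) ≡ 1 + shifted
  unshift = begin
    diagonalSum (suc n)
      ≡⟨ sumTo-zerosAbove (suc n) (suc (suc n)) _ (n≤1+n (suc n)) (vanishAbove (suc n) (2 ^_)) ⟨
    sumTo (suc (suc n)) (λ a → ((suc n ∸ a) C a) * 2 ^ a)
      ≡⟨ sumTo-suc (suc n) _ ⟩
    1 + shifted
      ∎

diagonalSum≡J : ∀ n → diagonalSum n ≡ J (suc n)
diagonalSum≡J zero          = refl
diagonalSum≡J (suc zero)    = refl
diagonalSum≡J (suc (suc n)) =
  trans (diagonalSum-rec n) (cong₂ (λ x y → x + 2 * y) (diagonalSum≡J (suc n)) (diagonalSum≡J n))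

summand : ℕ → ℕ → ℕ → ℕ
summand n k b = (((n ∸ k) + b) C (k ∸ b)) * ((k ∸ b) C b)

[k/2]<b⇒k∸b<b : ∀ k b → k / 2 < b → k ∸ b < b
[k/2]<b⇒k∸b<b k (suc b) k/2<b = m<n+o⇒m∸n<o k (suc b) k<2b
  where
  2b≤k⇒b≤k/2 : suc b * 2 ≤ k → suc b ≤ k / 2
  2b≤k⇒b≤k/2 2b≤k = subst (_≤ k / 2) (m*n/n≡m (suc b) 2) (/-monoˡ-≤ 2 2b≤k)
  k<2b : k < suc b + suc b
  k<2b = subst (k <_) (trans (*-comm (suc b) 2) (cong (suc b +_) (+-identityʳ (suc b))))
               (≰⇒> (λ 2b≤k → <⇒≱ k/2<b (2b≤k⇒b≤k/2 2b≤k)))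

b<lowerLim⇒[n∸k+b]<k∸b : ∀ n k b → k ≤ n → b < lowerLim n k → (n ∸ k) + b < k ∸ b
b<lowerLim⇒[n∸k+b]<k∸b n k b k≤n b<L = m+n≤o⇒m≤o∸n (suc ((n ∸ k) + b)) (+-cancelʳ-≤ k _ _ (begin
  suc ((n ∸ k) + b) + b + k   ≡⟨ rearrange (n ∸ k) b k ⟩
  suc (b * 2) + ((n ∸ k) + k) ≡⟨ cong (suc (b * 2) +_) (m∸n+n≡m k≤n) ⟩
  suc (b * 2) + n             ≤⟨ m≤o∸n⇒m+n≤o (suc (b * 2)) n≤2k 1+2b≤2k∸n ⟩
  2 * k                       ≡⟨ cong (k +_) (+-identityʳ k) ⟩
  k + k                       ∎))
  where
  open ≤-Reasoning
  rearrange : ∀ x b k → suc (x + b) + b + k ≡ suc (b * 2) + (x + k)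
  rearrange = solve-∀
  1+2b≤2k∸n : suc (b * 2) ≤ 2 * k ∸ n
  1+2b≤2k∸n = s≤s⁻¹ (≤-trans (*-monoˡ-≤ 2 b<L) (m/n*n≤m (suc (2 * k ∸ n)) 2))
  n≤2k : n ≤ 2 * k
  n≤2k = <⇒≤ (m∸n≢0⇒n<m (λ 2k∸n≡0 → <⇒≢ (≤-trans (s≤s z≤n) 1+2b≤2k∸n) (sym 2k∸n≡0)))

summand-vanishesAbove : ∀ n k b → k / 2 < b → summand n k b ≡ 0
summand-vanishesAbove n k b k/2<b =
  trans (cong ((((n ∸ k) + b) C (k ∸ b)) *_) (k>n⇒nCk≡0 ([k/2]<b⇒k∸b<b k b k/2<b)))
        (*-zeroʳ (((n ∸ k) + b) C (k ∸ b)))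

summand-vanishesBelow : ∀ n k → k ≤ n → ∀ b → b < lowerLim n k → summand n k b ≡ 0
summand-vanishesBelow n k k≤n b b<L = cong (_* _) (k>n⇒nCk≡0 (b<lowerLim⇒[n∸k+b]<k∸b n k b k≤n b<L))

innerSum≡sumTo : ∀ n k → k ≤ n → sumFromTo (lowerLim n k) (k / 2) (summand n k) ≡ sumTo k (summand n k)
innerSum≡sumTo n k k≤n = sumFromTo≡sumTo (lowerLim n k) (k / 2) k (summand n k) (m/n≤m k 2)
  (summand-vanishesBelow n k k≤n) (summand-vanishesAbove n k)

n∸k+b≡n∸[k∸b] : ∀ n k b → b ≤ k → k ≤ n → (n ∸ k) + b ≡ n ∸ (k ∸ b)
n∸k+b≡n∸[k∸b] n k b b≤k k≤n = begin
  (n ∸ k) + b                   ≡⟨ cong ((n ∸ k) +_) (m∸[m∸n]≡n b≤k) ⟨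
  (n ∸ k) + (k ∸ (k ∸ b))       ≡⟨ +-∸-assoc (n ∸ k) (m∸n≤m k b) ⟨
  ((n ∸ k) + k) ∸ (k ∸ b)       ≡⟨ cong (_∸ (k ∸ b)) (m∸n+n≡m k≤n) ⟩
  n ∸ (k ∸ b)                   ∎
  where open ≡-Reasoning

doubleSum≡diagonalSum : ∀ n → sumTo n (λ k → sumTo k (summand n k)) ≡ diagonalSum n
doubleSum≡diagonalSum n = begin
  sumTo n (λ k → sumTo k (summand n k))
    ≡⟨ sumTo-cong n (λ k k≤n → sumTo-cong k (λ b b≤k →
         cong (λ x → (x C (k ∸ b)) * ((k ∸ b) C b)) (n∸k+b≡n∸[k∸b] n k b b≤k k≤n))) ⟩
  sumTo n (λ k → sumTo k (λ b → ((n ∸ (k ∸ b)) C (k ∸ b)) * ((k ∸ b) C b)))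
    ≡⟨ sumTo-triangle (λ a b → ((n ∸ a) C a) * (a C b)) n ⟩
  sumTo n (λ a → sumTo (n ∸ a) (λ b → ((n ∸ a) C a) * (a C b)))
    ≡⟨ sumTo-cong n (λ a _ → sumTo-distribˡ-* (n ∸ a) ((n ∸ a) C a) (a C_)) ⟩
  sumTo n (λ a → ((n ∸ a) C a) * sumTo (n ∸ a) (a C_))
    ≡⟨ sumTo-cong n (λ a _ → rowSum a) ⟩
  diagonalSum n
    ∎
  where
  open ≡-Reasoning
  rowSum : ∀ a → ((n ∸ a) C a) * sumTo (n ∸ a) (a C_) ≡ ((n ∸ a) C a) * 2 ^ a
  rowSum a with a ≤? n ∸ a
  ... | yes a≤n∸a = cong (((n ∸ a) C a) *_) (sumTo-C a (n ∸ a) a≤n∸a)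
  ... | no  a≰n∸a rewrite k>n⇒nCk≡0 (≰⇒> a≰n∸a) = refl

corollary5p15 : ∀ (n : ℕ) →
    J (n + 1) ≡ sumTo n (λ k → sumFromTo (lowerLim n k) (k / 2)
                  (λ b → (((n ∸ k) + b) C (k ∸ b)) * ((k ∸ b) C b)))
corollary5p15 n = begin
  J (n + 1)                                   ≡⟨ cong J (+-comm n 1) ⟩
  J (suc n)                                   ≡⟨ diagonalSum≡J n ⟨
  diagonalSum n                               ≡⟨ doubleSum≡diagonalSum n ⟨
  sumTo n (λ k → sumTo k (summand n k))       ≡⟨ sumTo-cong n (λ k k≤n → innerSum≡sumTo n k k≤n) ⟨
  sumTo n (λ k → sumFromTo (lowerLim n k) (k / 2) (summand n k)) ∎
  where open ≡-Reasoning
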